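{- Let $G$ be an $n$-vertex ordered graph and let $\gamma,\delta>0$. If $e(G)\geq \gamma n^2$ and $G$ contains at most $\delta\gamma^3 n^3/32$ induced copies of $D$, then there exists $X\subseteq V(G)$ with $|X|\geq \gamma n/2$ and $d(X)\geq 1-\delta$.
   Context: An ordered graph is a graph with a linear order on its vertex set. $D$ is the ordered graph with vertices $x<y<z$ and edges $\{x,y\},\{x,z\}$; an induced copy of $D$ in $G$ is a triple $u<v<w$ with $\{u,v\},\{u,w\}\in E(G)$ and $\{v,w\}\notin E(G)$. For $X\subseteq V(G)$, $d(X)=e(X)/\binom{|X|}{2}$, where $e(X)$ is the number of edges inside $X$.
   Formalization: The parameters γ and δ range over the positive rationals. -}

module Defs where

open import Data.Bool using (Bool; true; false; _∧_; not)
open import Data.Nat using (ℕ; _<ᵇ_)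
open import Data.Fin using (Fin; toℕ)
open import Data.Fin.Subset using (Subset)
open import Data.List using (List; length; filterᵇ; cartesianProduct; allFin)
open import Data.Vec using (lookup)
open import Data.Product using (_×_; _,_)
open import Data.Integer using (+_)
open import Data.Rational using (ℚ; _/_)
open import Relation.Binary.PropositionalEquality using (_≡_)

-- An ordered graph on n vertices: vertex set Fin n with its natural order,
-- a simple undirected graph given by a symmetric irreflexive Boolean adjacency.
record OrderedGraph (n : ℕ) : Set where
  field
    adj    : Fin n → Fin n → Bool
    sym    : ∀ i j → adj i j ≡ adj j i
    irrefl : ∀ i → adj i i ≡ false
open OrderedGraph public

_<f_ : ∀ {n} → Fin n → Fin n → Bool
i <f j = toℕ i <ᵇ toℕ j

countᵇ : ∀ {A : Set} → (A → Bool) → List A → ℕ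
countᵇ p xs = length (filterᵇ p xs)

allPairs : (n : ℕ) → List (Fin n × Fin n)
allPairs n = cartesianProduct (allFin n) (allFin n)

allTriples : (n : ℕ) → List (Fin n × Fin n × Fin n)
allTriples n = cartesianProduct (allFin n) (allPairs n)

edgesIn : ∀ {n} → OrderedGraph n → Subset n → ℕ
edgesIn {n} G X =
  countᵇ (λ { (u , v) → (u <f v) ∧ lookup X u ∧ lookup X v ∧ adj G u v }) (allPairs n)

edges : ∀ {n} → OrderedGraph n → ℕ
edges {n} G = countᵇ (λ { (u , v) → (u <f v) ∧ adj G u v }) (allPairs n)

inducedD : ∀ {n} → OrderedGraph n → ℕ
inducedD {n} G =
  countᵇ (λ { (u , v , w) → (u <f v) ∧ (v <f w) ∧ adj G u v ∧ adj G u w ∧ not (adj G v w) })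
         (allTriples n)

ℕ→ℚ : ℕ → ℚ
ℕ→ℚ k = (+ k) / 1

module Submission where

-- For a vertex u let X_u be its forward neighbourhood {v > u : uv ∈ E}. The non-edges inside X_u are exactly
-- the induced copies of D with least vertex u, so e(X_u) + D_u = C(|X_u|, 2), and Σ_u |X_u| = e(G).
-- Put A = γn/2 and c = δA/4. If no X_u has |X_u| ≥ A and d(X_u) ≥ 1 - δ, then every u satisfies
-- c|X_u| ≤ D_u + cA: trivially when |X_u| < A, and otherwise because D_u > δ C(|X_u|, 2) ≥ δ|X_u|²/4.
-- Summing over u gives c e(G) ≤ #D + ncA, i.e. γ²/8 ≤ γ³/32 + γ²/16 after dividing by δn³,
-- which is impossible since γ ≤ 1.

module Counting where
  open import Defs
  open import Function using (_∘_; id)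
  open import Data.Bool using (Bool; true; false; _∧_; not; T)
  open import Data.Nat using (ℕ; zero; suc; _+_; _*_; _≤_; z≤n)
  open import Data.Nat.Properties
    using (+-0-commutativeMonoid; +-identityʳ; +-mono-≤; +-monoʳ-≤; *-monoˡ-≤; +-cancelʳ-≤;
           <ᵇ⇒<; <⇒<ᵇ; <-trans; module ≤-Reasoning)
  open import Data.Nat.Tactic.RingSolver using (solve-∀)
  open import Data.Nat.Combinatorics using (_C_; nCk+nC[k+1]≡[n+1]C[k+1]; nC1≡n)
  open import Algebra.Properties.CommutativeMonoid.Sum +-0-commutativeMonoid
    using (sum-syntax; sum-cong-≗; sum-replicate-zero; ∑-distrib-+)
  open import Data.Fin using (Fin; toℕ; zero; suc)
  open import Data.Fin.Subset using (Subset; ∣_∣)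
  open import Data.Fin.Subset.Properties using (∣p∣≤n)
  open import Data.List using ([]; _∷_; _++_; map; length; tabulate; cartesianProduct; filterᵇ)
  open import Data.List.Properties using (length-++; filter-++)
  open import Data.Vec using (lookup) renaming (tabulate to tabulateᵛ)
  open import Data.Vec.Properties using (lookup∘tabulate)
  open import Data.Product using (_×_; _,_)
  open import Relation.Nullary.Decidable using (T?)
  open import Relation.Binary.PropositionalEquality as ≡
    using (_≡_; refl; trans; cong; cong₂; module ≡-Reasoning)

  Bool→ℕ : Bool → ℕ
  Bool→ℕ true  = 1
  Bool→ℕ false = 0

  countᵇ-∷ : ∀ {A : Set} (p : A → Bool) x xs → countᵇ p (x ∷ xs) ≡ Bool→ℕ (p x) + countᵇ p xs
  countᵇ-∷ p x xs with p x
  ... | true  = refl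
  ... | false = refl

  countᵇ-++ : ∀ {A : Set} (p : A → Bool) xs ys → countᵇ p (xs ++ ys) ≡ countᵇ p xs + countᵇ p ys
  countᵇ-++ p xs ys = trans (cong length (filter-++ (T? ∘ p) xs ys)) (length-++ (filterᵇ p xs))

  countᵇ-map : ∀ {A B : Set} (p : B → Bool) (f : A → B) xs → countᵇ p (map f xs) ≡ countᵇ (p ∘ f) xs
  countᵇ-map p f []       = refl
  countᵇ-map p f (x ∷ xs) = begin
    countᵇ p (f x ∷ map f xs)              ≡⟨ countᵇ-∷ p (f x) (map f xs) ⟩
    Bool→ℕ (p (f x)) + countᵇ p (map f xs) ≡⟨ cong (_+_ (Bool→ℕ (p (f x)))) (countᵇ-map p f xs) ⟩
    Bool→ℕ (p (f x)) + countᵇ (p ∘ f) xs   ≡⟨ countᵇ-∷ (p ∘ f) x xs ⟨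
    countᵇ (p ∘ f) (x ∷ xs)                ∎
    where open ≡-Reasoning

  countᵇ-tabulate : ∀ {A : Set} {n} (p : A → Bool) (f : Fin n → A) →
                    countᵇ p (tabulate f) ≡ ∑[ i < n ] Bool→ℕ (p (f i))
  countᵇ-tabulate {n = zero}  p f = refl
  countᵇ-tabulate {n = suc n} p f =
    trans (countᵇ-∷ p (f zero) _) (cong (_+_ (Bool→ℕ (p (f zero)))) (countᵇ-tabulate p (f ∘ suc)))

  countᵇ-cartesianProduct : ∀ {A B : Set} {n} (p : A × B → Bool) (f : Fin n → A) ys →
    countᵇ p (cartesianProduct (tabulate f) ys) ≡ ∑[ i < n ] countᵇ (λ y → p (f i , y)) ys
  countᵇ-cartesianProduct {n = zero}  p f ys = refl
  countᵇ-cartesianProduct {n = suc n} p f ys = begin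
    countᵇ p (map (f zero ,_) ys ++ cartesianProduct (tabulate (f ∘ suc)) ys)
      ≡⟨ countᵇ-++ p (map (f zero ,_) ys) _ ⟩
    countᵇ p (map (f zero ,_) ys) + countᵇ p (cartesianProduct (tabulate (f ∘ suc)) ys)
      ≡⟨ cong₂ _+_ (countᵇ-map p (f zero ,_) ys) (countᵇ-cartesianProduct p (f ∘ suc) ys) ⟩
    ∑[ i < suc n ] countᵇ (λ y → p (f i , y)) ys ∎
    where open ≡-Reasoning

  countᵇ-allPairs : ∀ {n} (p : Fin n × Fin n → Bool) →
                    countᵇ p (allPairs n) ≡ ∑[ v < n ] ∑[ w < n ] Bool→ℕ (p (v , w))
  countᵇ-allPairs p = trans (countᵇ-cartesianProduct p id _)
                            (sum-cong-≗ (λ v → countᵇ-tabulate (λ w → p (v , w)) id))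

  countᵇ-allTriples : ∀ {n} (p : Fin n × Fin n × Fin n → Bool) →
                      countᵇ p (allTriples n) ≡ ∑[ u < n ] countᵇ (λ vw → p (u , vw)) (allPairs n)
  countᵇ-allTriples p = countᵇ-cartesianProduct p id _

  ∑-∧ˡ : ∀ {n} b (F : Fin n → Bool) → ∑[ i < n ] Bool→ℕ (b ∧ F i) ≡ Bool→ℕ b * ∑[ i < n ] Bool→ℕ (F i)
  ∑-∧ˡ     true  F = ≡.sym (+-identityʳ _)
  ∑-∧ˡ {n} false F = sum-replicate-zero n

  [1+n]C2≡n+nC2 : ∀ n → suc n C 2 ≡ n + n C 2
  [1+n]C2≡n+nC2 n = trans (≡.sym (nCk+nC[k+1]≡[n+1]C[k+1] n 1)) (cong (_+ n C 2) (nC1≡n n))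

  2*nC2+n≡n*n : ∀ n → 2 * (n C 2) + n ≡ n * n
  2*nC2+n≡n*n zero    = refl
  2*nC2+n≡n*n (suc n) = begin
    2 * (suc n C 2) + suc n         ≡⟨ cong (λ c → 2 * c + suc n) ([1+n]C2≡n+nC2 n) ⟩
    2 * (n + n C 2) + suc n         ≡⟨ regroup n (n C 2) ⟩
    (2 * (n C 2) + n) + (2 * n + 1) ≡⟨ cong (_+ (2 * n + 1)) (2*nC2+n≡n*n n) ⟩
    n * n + (2 * n + 1)             ≡⟨ square-suc n ⟩
    suc n * suc n                   ∎
    where
    open ≡-Reasoning
    regroup : ∀ n c → 2 * (n + c) + suc n ≡ (2 * c + n) + (2 * n + 1)
    regroup = solve-∀
    square-suc : ∀ n → n * n + (2 * n + 1) ≡ suc n * suc n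
    square-suc = solve-∀

  n*n≤4*nC2 : ∀ n → 2 ≤ n → n * n ≤ 4 * (n C 2)
  n*n≤4*nC2 n 2≤n = +-cancelʳ-≤ (n * n) (n * n) (4 * (n C 2)) (begin
    n * n + n * n                       ≡⟨ cong (λ s → s + s) (2*nC2+n≡n*n n) ⟨
    2 * (n C 2) + n + (2 * (n C 2) + n) ≡⟨ double (n C 2) n ⟩
    4 * (n C 2) + 2 * n                 ≤⟨ +-monoʳ-≤ (4 * (n C 2)) (*-monoˡ-≤ n 2≤n) ⟩
    4 * (n C 2) + n * n                 ∎)
    where
    open ≤-Reasoning
    double : ∀ c n → 2 * c + n + (2 * c + n) ≡ 4 * c + 2 * n
    double = solve-∀

  ∑-≤ : ∀ {n k} (f : Fin n → ℕ) → (∀ i → f i ≤ k) → ∑[ i < n ] f i ≤ n * k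
  ∑-≤ {zero}  f _   = z≤n
  ∑-≤ {suc n} f f≤k = +-mono-≤ (f≤k zero) (∑-≤ (f ∘ suc) (f≤k ∘ suc))

  ∣tabulate∣ : ∀ {n} (F : Fin n → Bool) → ∣ tabulateᵛ F ∣ ≡ ∑[ i < n ] Bool→ℕ (F i)
  ∣tabulate∣ {zero}  F = refl
  ∣tabulate∣ {suc n} F with F zero
  ... | true  = cong suc (∣tabulate∣ (F ∘ suc))
  ... | false = ∣tabulate∣ (F ∘ suc)

  pairsIn : ∀ {n} → (Fin n → Bool) → ℕ
  pairsIn {n} F = ∑[ v < n ] ∑[ w < n ] Bool→ℕ ((v <f w) ∧ F v ∧ F w)

  pairsIn≡C2 : ∀ {n} (F : Fin n → Bool) → pairsIn F ≡ (∑[ i < n ] Bool→ℕ (F i)) C 2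
  pairsIn≡C2 {zero}  F = refl
  -- Unfolding pairsIn F: in the row v = 0 only the w > 0 survive, and the column w = 0 vanishes
  -- because 0 is the least vertex.
  pairsIn≡C2 {suc n} F = begin
    ∑[ w < n ] Bool→ℕ (F zero ∧ F (suc w)) + pairsIn (F ∘ suc)
      ≡⟨ cong₂ _+_ (∑-∧ˡ (F zero) (F ∘ suc)) (pairsIn≡C2 (F ∘ suc)) ⟩
    Bool→ℕ (F zero) * k + k C 2
      ≡⟨ add-first (F zero) ⟩
    (Bool→ℕ (F zero) + k) C 2 ∎
    where
    open ≡-Reasoning
    k = ∑[ i < n ] Bool→ℕ (F (suc i))
    add-first : ∀ b → Bool→ℕ b * k + k C 2 ≡ (Bool→ℕ b + k) C 2
    add-first true  = trans (cong (_+ k C 2) (+-identityʳ k)) (≡.sym ([1+n]C2≡n+nC2 k))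
    add-first false = refl

  <f-trans : ∀ {n} {u v w : Fin n} → T (u <f v) → T (v <f w) → T (u <f w)
  <f-trans {u = u} {v} {w} u<v v<w =
    <⇒<ᵇ (<-trans (<ᵇ⇒< (toℕ u) (toℕ v) u<v) (<ᵇ⇒< (toℕ v) (toℕ w) v<w))

  split-by-adjacency : ∀ u<v v<w u<w uv uw vw → (T u<v → T v<w → T u<w) →
    Bool→ℕ (v<w ∧ (u<v ∧ uv) ∧ (u<w ∧ uw) ∧ vw) + Bool→ℕ (u<v ∧ v<w ∧ uv ∧ uw ∧ not vw)
      ≡ Bool→ℕ (v<w ∧ (u<v ∧ uv) ∧ (u<w ∧ uw))
  split-by-adjacency false false u<w uv uw vw transitive = refl
  split-by-adjacency false true  u<w uv uw vw transitive = refl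
  split-by-adjacency true  false u<w uv uw vw transitive = refl
  split-by-adjacency true  true  false uv uw vw transitive with transitive _ _
  ... | ()
  split-by-adjacency true  true  true false uw vw transitive = refl
  split-by-adjacency true  true  true true false vw transitive = refl
  split-by-adjacency true  true  true true true false transitive = refl
  split-by-adjacency true  true  true true true true transitive = refl

  module _ {n} (G : OrderedGraph n) where

    forward : Fin n → Fin n → Bool
    forward u v = (u <f v) ∧ adj G u v

    forwardNbhd : Fin n → Subset n
    forwardNbhd u = tabulateᵛ (forward u)

    inducedDFrom : Fin n → ℕ
    inducedDFrom u = countᵇ (λ { (v , w) → (u <f v) ∧ (v <f w) ∧ adj G u v ∧ adj G u w ∧ not (adj G v w) })
                            (allPairs n)

    edges≡∑∣forwardNbhd∣ : edges G ≡ ∑[ u < n ] ∣ forwardNbhd u ∣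
    edges≡∑∣forwardNbhd∣ = trans (countᵇ-allPairs {n} _) (sum-cong-≗ (λ u → ≡.sym (∣tabulate∣ (forward u))))

    edges≤n*n : edges G ≤ n * n
    edges≤n*n = ≡.subst (_≤ n * n) (≡.sym edges≡∑∣forwardNbhd∣)
                        (∑-≤ (λ u → ∣ forwardNbhd u ∣) (λ u → ∣p∣≤n (forwardNbhd u)))

    inducedD≡∑inducedDFrom : inducedD G ≡ ∑[ u < n ] inducedDFrom u
    inducedD≡∑inducedDFrom = countᵇ-allTriples {n} _

    edgesIn-forwardNbhd : ∀ u → edgesIn G (forwardNbhd u) + inducedDFrom u ≡ ∣ forwardNbhd u ∣ C 2
    edgesIn-forwardNbhd u = begin
      edgesIn G (forwardNbhd u) + inducedDFrom u
        ≡⟨ cong₂ _+_ (countᵇ-allPairs {n} _) (countᵇ-allPairs {n} _) ⟩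
      ∑[ v < n ] ∑[ w < n ] inX v w + ∑[ v < n ] ∑[ w < n ] inD v w
        ≡⟨ ∑-distrib-+ (λ v → ∑[ w < n ] inX v w) (λ v → ∑[ w < n ] inD v w) ⟨
      ∑[ v < n ] (∑[ w < n ] inX v w + ∑[ w < n ] inD v w)
        ≡⟨ sum-cong-≗ (λ v → ∑-distrib-+ (inX v) (inD v)) ⟨
      ∑[ v < n ] ∑[ w < n ] (inX v w + inD v w)
        ≡⟨ sum-cong-≗ (λ v → sum-cong-≗ (pointwise v)) ⟩
      pairsIn (forward u)
        ≡⟨ pairsIn≡C2 (forward u) ⟩
      (∑[ v < n ] Bool→ℕ (forward u v)) C 2
        ≡⟨ cong (_C 2) (∣tabulate∣ (forward u)) ⟨
      ∣ forwardNbhd u ∣ C 2 ∎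
      where
      open ≡-Reasoning
      inX inD : Fin n → Fin n → ℕ
      inX v w = Bool→ℕ ((v <f w) ∧ lookup (forwardNbhd u) v ∧ lookup (forwardNbhd u) w ∧ adj G v w)
      inD v w = Bool→ℕ ((u <f v) ∧ (v <f w) ∧ adj G u v ∧ adj G u w ∧ not (adj G v w))
      pointwise : ∀ v w → inX v w + inD v w ≡ Bool→ℕ ((v <f w) ∧ forward u v ∧ forward u w)
      pointwise v w rewrite lookup∘tabulate (forward u) v | lookup∘tabulate (forward u) w =
        split-by-adjacency (u <f v) (v <f w) (u <f w) (adj G u v) (adj G u w) (adj G v w)
                           (<f-trans {u = u} {v} {w})

module Estimates where
  open import Defs
  open import Function using (_∘_)
  open import Data.Nat as ℕ using (ℕ; zero; suc)
  import Data.Nat.Properties as ℕ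
  open import Data.Nat.Combinatorics using (_C_)
  open import Data.Nat.Coprimality using (1-coprimeTo) renaming (sym to coprime-sym)
  open import Data.Integer as ℤ using (+_)
  import Data.Integer.Properties as ℤP
  open import Data.Rational
    using (ℚ; mkℚ; 0ℚ; 1ℚ; ½; _/_; _+_; _-_; _*_; _<_; _≤_; _≤?_; positive; nonNegative)
  open import Data.Rational.Properties
  open import Data.Rational.Solver using (module +-*-Solver)
  open +-*-Solver
  open import Data.Fin using (Fin) renaming (zero to fzero; suc to fsuc)
  open import Algebra.Properties.CommutativeMonoid.Sum ℕ.+-0-commutativeMonoid using (sum-syntax)
  open import Data.Product using (_×_; _,_)
  open import Data.Empty using (⊥; ⊥-elim)
  open import Relation.Nullary using (¬_; yes; no)
  open import Relation.Nullary.Decidable using (from-no)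
  open import Relation.Binary.PropositionalEquality as ≡ using (_≡_; refl; cong; cong₂; subst)
  open Counting using (n*n≤4*nC2)

  p≤p+q : ∀ {p q} → 0ℚ ≤ q → p ≤ p + q
  p≤p+q {p} {q} 0≤q = subst (_≤ p + q) (+-identityʳ p) (+-monoʳ-≤ p 0≤q)

  p≤q+p : ∀ {p q} → 0ℚ ≤ q → p ≤ q + p
  p≤q+p {p} {q} 0≤q = subst (_≤ q + p) (+-identityˡ p) (+-monoˡ-≤ p 0≤q)

  0≤* : ∀ {p q} → 0ℚ ≤ p → 0ℚ ≤ q → 0ℚ ≤ p * q
  0≤* {p} {q} 0≤p 0≤q =
    nonNegative⁻¹ (p * q) {{nonNeg*nonNeg⇒nonNeg p {{nonNegative 0≤p}} q {{nonNegative 0≤q}}}}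

  *-monoˡ-≤-0≤ : ∀ {r p q} → 0ℚ ≤ r → p ≤ q → r * p ≤ r * q
  *-monoˡ-≤-0≤ {r} 0≤r = *-monoˡ-≤-nonNeg r {{nonNegative 0≤r}}

  ℕ→ℚ≡mkℚ : ∀ k → ℕ→ℚ k ≡ mkℚ (+ k) 0 (coprime-sym (1-coprimeTo k))
  ℕ→ℚ≡mkℚ k = normalize-coprime (coprime-sym (1-coprimeTo k))

  ℕ→ℚ-+ : ∀ a b → ℕ→ℚ (a ℕ.+ b) ≡ ℕ→ℚ a + ℕ→ℚ b
  ℕ→ℚ-+ a b rewrite ℕ→ℚ≡mkℚ a | ℕ→ℚ≡mkℚ b =
    cong (_/ 1) (≡.trans (ℤP.pos-+ a b) (≡.sym (cong₂ ℤ._+_ (ℤP.*-identityʳ (+ a)) (ℤP.*-identityʳ (+ b)))))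

  ℕ→ℚ-* : ∀ a b → ℕ→ℚ (a ℕ.* b) ≡ ℕ→ℚ a * ℕ→ℚ b
  ℕ→ℚ-* a b rewrite ℕ→ℚ≡mkℚ a | ℕ→ℚ≡mkℚ b = cong (_/ 1) (ℤP.pos-* a b)

  ℕ→ℚ-nonNeg : ∀ a → 0ℚ ≤ ℕ→ℚ a
  ℕ→ℚ-nonNeg a = nonNegative⁻¹ (ℕ→ℚ a) {{normalize-nonNeg a 1}}

  ℕ→ℚ-pos : ∀ a → 0ℚ < ℕ→ℚ (suc a)
  ℕ→ℚ-pos a = positive⁻¹ (ℕ→ℚ (suc a)) {{normalize-pos (suc a) 1}}

  ℕ→ℚ-mono-≤ : ∀ {a b} → a ℕ.≤ b → ℕ→ℚ a ≤ ℕ→ℚ b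
  ℕ→ℚ-mono-≤ {a} {b} a≤b rewrite ≡.sym (ℕ.m+[n∸m]≡n a≤b) | ℕ→ℚ-+ a (b ℕ.∸ a) =
    p≤p+q (ℕ→ℚ-nonNeg (b ℕ.∸ a))

  ¼ : ℚ
  ¼ = + 1 / 4

  e<[1-δ][e+m]⇒δ[e+m]<m : ∀ δ e m → ℕ→ℚ e < (1ℚ - δ) * ℕ→ℚ (e ℕ.+ m) → δ * ℕ→ℚ (e ℕ.+ m) < ℕ→ℚ m
  e<[1-δ][e+m]⇒δ[e+m]<m δ e m e< rewrite ℕ→ℚ-+ e m = begin-strict
    δ * (E + M)                             ≡⟨ split E M δ ⟩
    E + (δ * (E + M) - E)                   <⟨ +-monoˡ-< (δ * (E + M) - E) e< ⟩
    (1ℚ - δ) * (E + M) + (δ * (E + M) - E)  ≡⟨ collapse E M δ ⟩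
    M                                       ∎
    where
    open ≤-Reasoning
    E = ℕ→ℚ e
    M = ℕ→ℚ m
    split : ∀ e m δ → δ * (e + m) ≡ e + (δ * (e + m) - e)
    split = solve 3 (λ e m δ → δ :* (e :+ m) := e :+ (δ :* (e :+ m) :- e)) refl
    collapse : ∀ e m δ → (1ℚ - δ) * (e + m) + (δ * (e + m) - e) ≡ m
    collapse = solve 3 (λ e m δ → (con 1ℚ :- δ) :* (e :+ m) :+ (δ :* (e :+ m) :- e) := m) refl

  δA¼d≤δ[dC2] : ∀ {δ A} d → 0ℚ ≤ δ → A ≤ ℕ→ℚ d → 2 ℕ.≤ d → δ * A * ¼ * ℕ→ℚ d ≤ δ * ℕ→ℚ (d C 2)
  δA¼d≤δ[dC2] {δ} {A} d 0≤δ A≤d 2≤d = begin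
    δ * A * ¼ * D                  ≡⟨ swap δ A D ⟩
    δ * ¼ * D * A                  ≤⟨ *-monoˡ-≤-0≤ (0≤* 0≤δ¼ (ℕ→ℚ-nonNeg d)) A≤d ⟩
    δ * ¼ * D * D                  ≡⟨ ≡.trans (*-assoc (δ * ¼) D D) (cong (δ * ¼ *_) (≡.sym (ℕ→ℚ-* d d))) ⟩
    δ * ¼ * ℕ→ℚ (d ℕ.* d)          ≤⟨ *-monoˡ-≤-0≤ 0≤δ¼ (ℕ→ℚ-mono-≤ (n*n≤4*nC2 d 2≤d)) ⟩
    δ * ¼ * ℕ→ℚ (4 ℕ.* (d C 2))    ≡⟨ cong (δ * ¼ *_) (ℕ→ℚ-* 4 (d C 2)) ⟩
    δ * ¼ * (ℕ→ℚ 4 * ℕ→ℚ (d C 2))  ≡⟨ cancel δ (ℕ→ℚ (d C 2)) ⟩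
    δ * ℕ→ℚ (d C 2)                ∎
    where
    open ≤-Reasoning
    D = ℕ→ℚ d
    0≤δ¼ = 0≤* 0≤δ (nonNegative⁻¹ ¼)
    swap : ∀ δ A D → δ * A * ¼ * D ≡ δ * ¼ * D * A
    swap = solve 3 (λ δ A D → δ :* A :* con ¼ :* D := δ :* con ¼ :* D :* A) refl
    cancel : ∀ δ C → δ * ¼ * (ℕ→ℚ 4 * C) ≡ δ * C
    cancel = solve 2 (λ δ C → δ :* con ¼ :* (con (ℕ→ℚ 4) :* C) := δ :* C) refl

  ¬dense⇒cd≤m+cA : ∀ {δ A} → 0ℚ ≤ δ → 0ℚ ≤ A → ∀ d e m → e ℕ.+ m ≡ d C 2 →
    ¬ (A ≤ ℕ→ℚ d × (1ℚ - δ) * ℕ→ℚ (d C 2) ≤ ℕ→ℚ e) →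
    δ * A * ¼ * ℕ→ℚ d ≤ ℕ→ℚ m + δ * A * ¼ * A
  ¬dense⇒cd≤m+cA {δ} {A} 0≤δ 0≤A d e m e+m≡C ¬dense with A ≤? ℕ→ℚ d
  ... | no A≰d  = ≤-trans (*-monoˡ-≤-0≤ 0≤c (<⇒≤ (≰⇒> A≰d))) (p≤q+p (ℕ→ℚ-nonNeg m))
    where 0≤c = 0≤* (0≤* 0≤δ 0≤A) (nonNegative⁻¹ ¼)
  ... | yes A≤d = begin
    δ * A * ¼ * ℕ→ℚ d          ≤⟨ δA¼d≤δ[dC2] d 0≤δ A≤d (2≤d d e+m≡C δC<m) ⟩
    δ * ℕ→ℚ (d C 2)            ≤⟨ <⇒≤ δC<m ⟩
    ℕ→ℚ m                      ≤⟨ p≤p+q (0≤* (0≤* (0≤* 0≤δ 0≤A) (nonNegative⁻¹ ¼)) 0≤A) ⟩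
    ℕ→ℚ m + δ * A * ¼ * A      ∎
    where
    open ≤-Reasoning
    δC<m : δ * ℕ→ℚ (d C 2) < ℕ→ℚ m
    δC<m = subst (λ c → δ * ℕ→ℚ c < ℕ→ℚ m) e+m≡C (e<[1-δ][e+m]⇒δ[e+m]<m δ e m (≰⇒> λ e≮ →
             ¬dense (A≤d , subst (λ c → (1ℚ - δ) * ℕ→ℚ c ≤ ℕ→ℚ e) e+m≡C e≮)))
    C2≡0-absurd : e ℕ.+ m ≡ 0 → δ * 0ℚ < ℕ→ℚ m → ⊥
    C2≡0-absurd e+m≡0 δ0<m rewrite ℕ.m+n≡0⇒n≡0 e e+m≡0 | *-zeroʳ δ = <-irrefl refl δ0<m
    2≤d : ∀ d → e ℕ.+ m ≡ d C 2 → δ * ℕ→ℚ (d C 2) < ℕ→ℚ m → 2 ℕ.≤ d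
    2≤d (suc (suc _)) _ _ = ℕ.s≤s (ℕ.s≤s ℕ.z≤n)
    2≤d 0 e+m≡0 δ0<m = ⊥-elim (C2≡0-absurd e+m≡0 δ0<m)
    2≤d 1 e+m≡0 δ0<m = ⊥-elim (C2≡0-absurd e+m≡0 δ0<m)

  ∑-affine-≤ : ∀ {n} (f g : Fin n → ℕ) c k → (∀ i → c * ℕ→ℚ (f i) ≤ ℕ→ℚ (g i) + k) →
               c * ℕ→ℚ (∑[ i < n ] f i) ≤ ℕ→ℚ (∑[ i < n ] g i) + ℕ→ℚ n * k
  ∑-affine-≤ {zero}  f g c k _ = ≤-reflexive (solve 2 (λ c k → c :* con 0ℚ := con 0ℚ :+ con 0ℚ :* k) refl c k)
  ∑-affine-≤ {suc n} f g c k f≤g = begin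
    c * ℕ→ℚ (f fzero ℕ.+ Σf)                ≡⟨ cong (c *_) (ℕ→ℚ-+ (f fzero) Σf) ⟩
    c * (ℕ→ℚ (f fzero) + ℕ→ℚ Σf)            ≡⟨ *-distribˡ-+ c (ℕ→ℚ (f fzero)) (ℕ→ℚ Σf) ⟩
    c * ℕ→ℚ (f fzero) + c * ℕ→ℚ Σf          ≤⟨ +-mono-≤ (f≤g fzero) (∑-affine-≤ (f ∘ fsuc) (g ∘ fsuc) c k (f≤g ∘ fsuc)) ⟩
    (G₀ + k) + (ℕ→ℚ Σg + N * k)             ≡⟨ regroup G₀ (ℕ→ℚ Σg) N k ⟩
    (G₀ + ℕ→ℚ Σg) + (1ℚ + N) * k            ≡⟨ cong₂ (λ s t → s + t * k) (ℕ→ℚ-+ (g fzero) Σg) (ℕ→ℚ-+ 1 n) ⟨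
    ℕ→ℚ (g fzero ℕ.+ Σg) + ℕ→ℚ (suc n) * k  ∎
    where
    open ≤-Reasoning
    Σf = ∑[ i < n ] f (fsuc i)
    Σg = ∑[ i < n ] g (fsuc i)
    G₀ = ℕ→ℚ (g fzero)
    N = ℕ→ℚ n
    regroup : ∀ a b n k → (a + k) + (b + n * k) ≡ (a + b) + (1ℚ + n) * k
    regroup = solve 4 (λ a b n k → (a :+ k) :+ (b :+ n :* k) := (a :+ b) :+ (con 1ℚ :+ n) :* k) refl

  ℕ→ℚ-^3 : ∀ n → ℕ→ℚ (n ℕ.^ 3) ≡ ℕ→ℚ n * (ℕ→ℚ n * ℕ→ℚ n)
  ℕ→ℚ-^3 n = begin
    ℕ→ℚ (n ℕ.* (n ℕ.* (n ℕ.* 1)))   ≡⟨ cong (λ k → ℕ→ℚ (n ℕ.* (n ℕ.* k))) (ℕ.*-identityʳ n) ⟩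
    ℕ→ℚ (n ℕ.* (n ℕ.* n))           ≡⟨ ℕ→ℚ-* n (n ℕ.* n) ⟩
    ℕ→ℚ n * ℕ→ℚ (n ℕ.* n)           ≡⟨ cong (ℕ→ℚ n *_) (ℕ→ℚ-* n n) ⟩
    ℕ→ℚ n * (ℕ→ℚ n * ℕ→ℚ n)         ∎
    where open ≡.≡-Reasoning

  density-contradiction : ∀ {γ δ N E D} → 0ℚ < γ → 0ℚ < δ → 0ℚ < N →
    γ * (N * N) ≤ E → E ≤ N * N → D ≤ δ * (γ * γ * γ) * (N * (N * N)) * (+ 1 / 32) →
    δ * (γ * N * ½) * ¼ * E ≤ D + N * (δ * (γ * N * ½) * ¼ * (γ * N * ½)) → ⊥
  density-contradiction {γ} {δ} {N} {E} {D} 0<γ 0<δ 0<N γN²≤E E≤N² D≤ cE≤ =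
    from-no (+ 1 / 8 ≤? + 3 / 32) (*-cancelˡ-≤-pos K {{K-pos}} K/8≤3K/32)
    where
    open ≤-Reasoning
    instance
      _ = positive 0<γ
      _ = positive 0<δ
      _ = positive 0<N
    N²-pos = pos*pos⇒pos N N
    K = δ * (γ * γ) * (N * (N * N))
    K-pos = pos*pos⇒pos (δ * (γ * γ)) {{pos*pos⇒pos δ (γ * γ) {{pos*pos⇒pos γ γ}}}}
                        (N * (N * N)) {{pos*pos⇒pos N (N * N) {{N²-pos}}}}
    A = γ * N * ½
    c = δ * A * ¼
    0≤c : 0ℚ ≤ c
    0≤c = 0≤* (0≤* (<⇒≤ 0<δ) (0≤* (0≤* (<⇒≤ 0<γ) (<⇒≤ 0<N)) (nonNegative⁻¹ ½))) (nonNegative⁻¹ ¼)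
    γ≤1 : γ ≤ 1ℚ
    γ≤1 = *-cancelʳ-≤-pos (N * N) {{N²-pos}}
            (≤-trans γN²≤E (≤-trans E≤N² (≤-reflexive (≡.sym (*-identityˡ (N * N))))))
    0≤K/32 : 0ℚ ≤ K * (+ 1 / 32)
    0≤K/32 = 0≤* (<⇒≤ (positive⁻¹ K {{K-pos}})) (nonNegative⁻¹ (+ 1 / 32))
    K/8≤3K/32 : K * (+ 1 / 8) ≤ K * (+ 3 / 32)
    K/8≤3K/32 = begin
      K * (+ 1 / 8)                                        ≡⟨ lhs δ γ N ⟩
      c * (γ * (N * N))                                    ≤⟨ *-monoˡ-≤-0≤ 0≤c γN²≤E ⟩
      c * E                                                ≤⟨ cE≤ ⟩
      D + N * (c * A)                                      ≤⟨ +-monoˡ-≤ (N * (c * A)) D≤ ⟩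
      δ * (γ * γ * γ) * (N * (N * N)) * (+ 1 / 32) + N * (c * A)
                                                           ≡⟨ rhs δ γ N ⟩
      K * (+ 1 / 32) * γ + K * (+ 1 / 16)                  ≤⟨ +-monoˡ-≤ (K * (+ 1 / 16)) (*-monoˡ-≤-0≤ 0≤K/32 γ≤1) ⟩
      K * (+ 1 / 32) * 1ℚ + K * (+ 1 / 16)                 ≡⟨ sum-fractions K ⟩
      K * (+ 3 / 32)                                       ∎
      where
      lhs : ∀ δ γ N → δ * (γ * γ) * (N * (N * N)) * (+ 1 / 8) ≡ δ * (γ * N * ½) * ¼ * (γ * (N * N))
      lhs = solve 3 (λ δ γ N → δ :* (γ :* γ) :* (N :* (N :* N)) :* con (+ 1 / 8)
                           := δ :* (γ :* N :* con ½) :* con ¼ :* (γ :* (N :* N))) refl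
      rhs : ∀ δ γ N → δ * (γ * γ * γ) * (N * (N * N)) * (+ 1 / 32) + N * (δ * (γ * N * ½) * ¼ * (γ * N * ½))
                    ≡ δ * (γ * γ) * (N * (N * N)) * (+ 1 / 32) * γ + δ * (γ * γ) * (N * (N * N)) * (+ 1 / 16)
      rhs = solve 3 (λ δ γ N → δ :* (γ :* γ :* γ) :* (N :* (N :* N)) :* con (+ 1 / 32)
                               :+ N :* (δ :* (γ :* N :* con ½) :* con ¼ :* (γ :* N :* con ½))
                           := δ :* (γ :* γ) :* (N :* (N :* N)) :* con (+ 1 / 32) :* γ
                               :+ δ :* (γ :* γ) :* (N :* (N :* N)) :* con (+ 1 / 16)) refl
      sum-fractions : ∀ K → K * (+ 1 / 32) * 1ℚ + K * (+ 1 / 16) ≡ K * (+ 3 / 32)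
      sum-fractions = solve 1 (λ K → K :* con (+ 1 / 32) :* con 1ℚ :+ K :* con (+ 1 / 16)
                                   := K :* con (+ 3 / 32)) refl

open import Defs
open import Data.Nat using (ℕ; _*_; _^_)
open import Data.Nat.Combinatorics using (_C_)
open import Data.Fin.Subset using (Subset; ∣_∣)
open import Data.Product using (Σ; _×_)
open import Data.Integer using (+_)
open import Data.Rational using (ℚ; 0ℚ; 1ℚ; _/_; _<_; _≤_; _-_) renaming (_*_ to _*ℚ_)
open import Function using (_∘_; case_of_)
open import Data.Nat using (zero; suc)
open import Data.Vec using ([])
open import Data.Fin.Properties using (any?)
open import Data.Product using (_,_)
open import Data.Empty using (⊥-elim)
open import Data.Rational using (½; _+_; _≤?_)
open import Data.Rational.Properties using (≤-reflexive; <⇒≤; *-zeroˡ; *-zeroʳ; nonNegative⁻¹)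
open import Relation.Nullary using (¬_; Dec; yes; no)
open import Relation.Nullary.Decidable using (_×-dec_)
open import Relation.Binary.PropositionalEquality as ≡ using (trans; cong; subst; subst₂)
open Counting
open Estimates

lemma2p2 : (n : ℕ) (G : OrderedGraph n) (γ δ : ℚ) →
    0ℚ < γ → 0ℚ < δ →
    γ *ℚ ℕ→ℚ (n * n) ≤ ℕ→ℚ (edges G) →
    ℕ→ℚ (inducedD G) ≤ δ *ℚ (γ *ℚ γ *ℚ γ) *ℚ ℕ→ℚ (n ^ 3) *ℚ ((+ 1) / 32) →
    Σ (Subset n) λ X →
    (γ *ℚ ℕ→ℚ n *ℚ ((+ 1) / 2) ≤ ℕ→ℚ ∣ X ∣)
    × ((1ℚ - δ) *ℚ ℕ→ℚ (∣ X ∣ C 2) ≤ ℕ→ℚ (edgesIn G X))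
lemma2p2 zero G γ δ _ _ _ _ =
  [] , ≤-reflexive (trans (cong (_*ℚ ½) (*-zeroʳ γ)) (*-zeroˡ ½)) , ≤-reflexive (*-zeroʳ (1ℚ - δ))
lemma2p2 n@(suc m) G γ δ 0<γ 0<δ many-edges few-D = case any? (dense? ∘ forwardNbhd G) of λ where
    (yes (u , X-dense)) → forwardNbhd G u , X-dense
    (no none) → ⊥-elim (density-contradiction 0<γ 0<δ (ℕ→ℚ-pos m) γN²≤E E≤N² D≤
                          (averaged (λ u → none ∘ (u ,_))))
  where
  N = ℕ→ℚ n
  A = γ *ℚ N *ℚ ½
  c = δ *ℚ A *ℚ ¼
  Dense : Subset n → Set
  Dense X = (A ≤ ℕ→ℚ ∣ X ∣) × ((1ℚ - δ) *ℚ ℕ→ℚ (∣ X ∣ C 2) ≤ ℕ→ℚ (edgesIn G X))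
  dense? : ∀ X → Dec (Dense X)
  dense? X = (A ≤? ℕ→ℚ ∣ X ∣) ×-dec ((1ℚ - δ) *ℚ ℕ→ℚ (∣ X ∣ C 2) ≤? ℕ→ℚ (edgesIn G X))
  γN²≤E = subst (λ x → γ *ℚ x ≤ ℕ→ℚ (edges G)) (ℕ→ℚ-* n n) many-edges
  E≤N² = subst (ℕ→ℚ (edges G) ≤_) (ℕ→ℚ-* n n) (ℕ→ℚ-mono-≤ (edges≤n*n G))
  D≤ = subst (λ x → ℕ→ℚ (inducedD G) ≤ δ *ℚ (γ *ℚ γ *ℚ γ) *ℚ x *ℚ (+ 1 / 32)) (ℕ→ℚ-^3 n) few-D
  0≤A = 0≤* (0≤* (<⇒≤ 0<γ) (ℕ→ℚ-nonNeg n)) (nonNegative⁻¹ ½)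
  averaged : (∀ u → ¬ Dense (forwardNbhd G u)) → c *ℚ ℕ→ℚ (edges G) ≤ ℕ→ℚ (inducedD G) + N *ℚ (c *ℚ A)
  averaged sparse = subst₂ (λ e d → c *ℚ ℕ→ℚ e ≤ ℕ→ℚ d + N *ℚ (c *ℚ A))
    (≡.sym (edges≡∑∣forwardNbhd∣ G)) (≡.sym (inducedD≡∑inducedDFrom G))
    (∑-affine-≤ (λ u → ∣ forwardNbhd G u ∣) (inducedDFrom G) c (c *ℚ A) λ u →
      ¬dense⇒cd≤m+cA (<⇒≤ 0<δ) 0≤A ∣ forwardNbhd G u ∣ (edgesIn G (forwardNbhd G u)) (inducedDFrom G u)
        (edgesIn-forwardNbhd G u) (sparse u))
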